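{- No bipartite graph has an orientation which is an antistrong digraph.
   Context: In a walk (in the underlying graph) of a digraph an arc $vw$ is forward if traversed from $v$ to $w$ and backward if traversed from $w$ to $v$. An antidirected trail is a walk with no repeated arc whose arcs alternate between forward and backward; it is a forward antidirected trail if it begins and ends with a forward arc. A digraph is antistrong if it has at least three vertices and contains a forward antidirected $(x,y)$-trail for every pair of distinct vertices $x,y$. -}

module Defs where

open import Data.Nat using (ℕ; _≥_)
open import Data.Fin using (Fin)
open import Data.Bool using (Bool)
open import Data.Product using (_×_; _,_; ∃-syntax; Σ-syntax)
open import Data.Sum using (_⊎_)
open import Data.List using (List; []; _∷_)
open import Data.List.Relation.Unary.Unique.Propositional using (Unique)
open import Relation.Nullary using (¬_)
open import Relation.Binary.PropositionalEquality using (_≡_; _≢_)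
open import Level using (0ℓ; suc)

record Graph : Set₁ where
  field
    n     : ℕ
    Edge  : Fin n → Fin n → Set
    sym   : ∀ {x y} → Edge x y → Edge y x
    irr   : ∀ {x} → ¬ Edge x x
open Graph public

Bipartite : Graph → Set
Bipartite G = Σ[ c ∈ (Fin (n G) → Bool) ] (∀ {x y} → Edge G x y → c x ≢ c y)

record Digraph : Set₁ where
  field
    vn  : ℕ
    Arc : Fin vn → Fin vn → Set
open Digraph public

record IsOrientation (G : Graph) (A : Fin (n G) → Fin (n G) → Set) : Set where
  field
    arc⇒edge : ∀ {x y} → A x y → Edge G x y
    edge⇒arc : ∀ {x y} → Edge G x y → A x y ⊎ A y x
    one-dir  : ∀ {x y} → A x y → ¬ A y x

-- Forward antidirected walk from x to y, recording the arcs used (as ordered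
-- pairs (tail , head)) in order of traversal.
data FAWalk {m : ℕ} (A : Fin m → Fin m → Set) :
            Fin m → Fin m → List (Fin m × Fin m) → Set where
  last : ∀ {x y} → A x y → FAWalk A x y ((x , y) ∷ [])
  step : ∀ {x z w y as} → A x z → A w z → FAWalk A w y as →
         FAWalk A x y ((x , z) ∷ (w , z) ∷ as)

FATrail : {m : ℕ} (A : Fin m → Fin m → Set) → Fin m → Fin m → Set
FATrail A x y = ∃[ as ] (FAWalk A x y as × Unique as)

Antistrong : Digraph → Set
Antistrong D = (vn D ≥ 3) × (∀ (x y : Fin (vn D)) → x ≢ y → FATrail (Arc D) x y)

digraphOn : (G : Graph) → (Fin (n G) → Fin (n G) → Set) → Digraph
digraphOn G A = record { vn = n G ; Arc = A }

-- Take a proper 2-colouring of the bipartite graph. A forward antidirected walk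
-- changes colour on its first arc, and every later backward/forward pair of arcs
-- shares a head, so it returns to the same colour: the ends of such a walk have
-- different colours. With three vertices, two distinct ones share a colour.
module Submission where

open import Defs hiding (sym)
open import Data.Bool using (Bool; not)
open import Data.Bool.Properties using (¬-not; not-¬; not-injective)
open import Data.Fin using (Fin)
open import Data.Fin.Properties using (2↔Bool; pigeonhole; <⇒≢)
open import Data.Nat using (_<_)
open import Data.Product using (_,_; ∃₂; _×_)
open import Function using (_∘_; _↣_; Injection)
open import Function.Properties.Inverse using (↔-sym; ↔⇒↣)
open import Relation.Nullary using (¬_)
open import Relation.Binary.PropositionalEquality using (_≡_; _≢_; sym; trans; cong)

ProperColouring : ∀ {m} → (Fin m → Fin m → Set) → (Fin m → Bool) → Set
ProperColouring A c = ∀ {x y} → A x y → c x ≢ c y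

module _ {m} {A : Fin m → Fin m → Set} {c : Fin m → Bool}
         (proper : ProperColouring A c) where

  arc-flips-colour : ∀ {x y} → A x y → c y ≡ not (c x)
  arc-flips-colour xy = ¬-not (proper xy ∘ sym)

  FAWalk-flips-colour : ∀ {x y as} → FAWalk A x y as → c y ≡ not (c x)
  FAWalk-flips-colour (last xy) = arc-flips-colour xy
  FAWalk-flips-colour (step {x} {z} {w} xz wz walk) =
    trans (FAWalk-flips-colour walk) (cong not w≡x)
    where
    w≡x : c w ≡ c x
    w≡x = not-injective (trans (sym (arc-flips-colour wz)) (arc-flips-colour xz))

  FAWalk-ends-differ : ∀ {x y as} → FAWalk A x y as → c x ≢ c y
  FAWalk-ends-differ walk cx≡cy = not-¬ (sym cx≡cy) (FAWalk-flips-colour walk)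

Bool↣Fin2 : Bool ↣ Fin 2
Bool↣Fin2 = ↔⇒↣ (↔-sym 2↔Bool)

Bool-pigeonhole : ∀ {m} → 2 < m → (c : Fin m → Bool) → ∃₂ λ i j → i ≢ j × c i ≡ c j
Bool-pigeonhole 2<m c
  with i , j , i<j , ci≡cj ← pigeonhole 2<m (Injection.to Bool↣Fin2 ∘ c)
  = i , j , <⇒≢ i<j , Injection.injective Bool↣Fin2 ci≡cj

proposition6p1 : (G : Graph) → Bipartite G →
                 (A : Fin (n G) → Fin (n G) → Set) → IsOrientation G A →
                 ¬ Antistrong (digraphOn G A)
proposition6p1 G (c , bipartite) A orientation (n≥3 , trail)
  with x , y , x≢y , cx≡cy ← Bool-pigeonhole n≥3 c
  with _ , walk , _ ← trail x y x≢y
  = FAWalk-ends-differ proper walk cx≡cy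
  where
  proper : ProperColouring A c
  proper = bipartite ∘ IsOrientation.arc⇒edge orientation
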